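{- For all integers $\ell\ge 3$ and $r\ge 3$, $$\mathrm{ER}(3,\ell+1,r)\ge (\mathrm{ER}(3,\ell,r)-1)\cdot(\mathrm{ER}(3,3,r)-1)+1.$$
   Context: An edge-coloring of $K_n$ is any map $\chi:E(K_n)\to\omega$ (arbitrarily many colors allowed). A clique is monochromatic if all its edges have the same color, and rainbow if all its edges have pairwise distinct colors. A coloring of a clique $K_s$ is lexical if there is an ordering $v_1,\dots,v_s$ of its vertices such that for $i<j$ and $i'<j'$, $\chi(v_iv_j)=\chi(v_{i'}v_{j'})$ if and only if $i=i'$. $\mathrm{ER}(m,\ell,r)$ is the minimum $n$ such that every edge-coloring $\chi:E(K_n)\to\omega$ contains a monochromatic $K_m$, a lexical $K_\ell$, or a rainbow $K_r$. -}

module Defs where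

open import Data.Nat using (ℕ; suc)
open import Data.Fin using (Fin; _<_; _<?_)
open import Data.Product using (Σ; _×_)
open import Function.Definitions using (Injective)
open import Relation.Binary.PropositionalEquality using (_≡_)
open import Relation.Nullary using (¬_; yes; no)
open import Function.Bundles using (_⇔_)

-- An edge-colouring of K_n with colours in ω = ℕ.  We represent it by an
-- arbitrary function on ordered pairs; the colour of the (unordered) edge
-- {x,y} with x ≠ y is read off at the pair ordered increasingly.  Every
-- edge-colouring arises this way and every such function gives one.
Colouring : ℕ → Set
Colouring n = Fin n → Fin n → ℕ

edgeCol : ∀ {n} → Colouring n → Fin n → Fin n → ℕ
edgeCol χ x y with x <? y
... | yes _ = χ x y
... | no _  = χ y x

-- A copy of K_s in K_n: an injective map of vertices Fin s → Fin n.
-- The order on Fin s gives the vertex ordering v_1, …, v_s.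
Embedding : ℕ → ℕ → Set
Embedding s n = Σ (Fin s → Fin n) λ f → Injective _≡_ _≡_ f

Mono : ∀ {s n} → Colouring n → (Fin s → Fin n) → Set
Mono χ f = ∀ i j i' j' → i < j → i' < j' →
  edgeCol χ (f i) (f j) ≡ edgeCol χ (f i') (f j')

Rainbow : ∀ {s n} → Colouring n → (Fin s → Fin n) → Set
Rainbow χ f = ∀ i j i' j' → i < j → i' < j' →
  edgeCol χ (f i) (f j) ≡ edgeCol χ (f i') (f j') → (i ≡ i') × (j ≡ j')

Lexical : ∀ {s n} → Colouring n → (Fin s → Fin n) → Set
Lexical χ f = ∀ i j i' j' → i < j → i' < j' →
  (edgeCol χ (f i) (f j) ≡ edgeCol χ (f i') (f j')) ⇔ (i ≡ i')

-- A clique K_s is lexical if SOME ordering of its vertices works; since f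
-- ranges over all injections Fin s → Fin n (all orderings of all s-sets),
-- existence of a lexical K_s is existence of an embedding f with Lexical χ f.
HasMono HasLex HasRainbow : ∀ {n} → ℕ → Colouring n → Set
HasMono    {n} m χ = Σ (Embedding m n) λ e → Mono χ (Data.Product.proj₁ e)
HasLex     {n} l χ = Σ (Embedding l n) λ e → Lexical χ (Data.Product.proj₁ e)
HasRainbow {n} r χ = Σ (Embedding r n) λ e → Rainbow χ (Data.Product.proj₁ e)

open import Data.Sum using (_⊎_)

Arrows : ℕ → ℕ → ℕ → ℕ → Set
Arrows n m l r = (χ : Colouring n) → HasMono m χ ⊎ (HasLex l χ ⊎ HasRainbow r χ)

IsER : ℕ → ℕ → ℕ → ℕ → Set
IsER N m l r = Arrows N m l r × (∀ n → n Data.Nat.< N → ¬ Arrows n m l r)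

-- Blow up every vertex of a colouring χ₁ of K_A into a copy of K_B coloured by χ₂, colouring edges
-- inside a block by χ₂ and edges between blocks by χ₁, with disjoint palettes. A monochromatic or
-- rainbow clique of the product lies in one block or meets each block at most once, so it comes from
-- χ₂ or from χ₁. In a lexical K_(l+1), either the first l vertices lie in distinct blocks (a lexical
-- K_l of χ₁), or two of them v_i, v_j share a block; then the edge from v_i to the last vertex has
-- the colour of v_i v_j, so the last vertex is in that block too and v_i, v_j, v_last is a lexical
-- K_3 of χ₂. Decidability of the three properties lets the proof pick χ₁ and χ₂ constructively.
module Submission where

open import Defs
open import Data.Nat as ℕ using (ℕ; suc; _+_; _*_; _∸_; _≤_; _≰_; s≤s)
open import Data.Nat.Properties using (even≢odd; *-cancelˡ-≡; suc-injective; +-comm; ≰⇒>; n<1+n)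
open import Data.Fin
  using (Fin; zero; suc; toℕ; _<_; _<?_; _≟_; remQuot; combine; inject≤; inject₁; fromℕ)
open import Data.Fin.Properties
  using (¬Fin0; <-asym; <-cmp; <-trans; <⇒≢; any?; all?; combine-remQuot; inject≤-injective;
         toℕ-inject₁; inject₁-injective; toℕ-fromℕ; toℕ<n; ℕ<⇒inject₁<)
open import Data.Vec.Functional using (_∷_; head; tail)
open import Data.Product using (Σ; ∃; ∃₂; _×_; _,_; proj₁; proj₂)
open import Data.Sum using (_⊎_; inj₁; inj₂)
import Data.Sum as Sum
open import Data.Empty using (⊥-elim)
open import Function using (_∘_; id; flip; case_of_)
open import Function.Bundles using (_⇔_; mk⇔; Equivalence)
open import Function.Definitions using (Injective)
open import Relation.Binary using (tri<; tri≈; tri>; _Preserves_⟶_)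
open import Relation.Binary.PropositionalEquality
  using (_≡_; _≢_; refl; sym; trans; cong; cong₂; subst; subst₂; module ≡-Reasoning)
open import Relation.Nullary using (¬_; Dec; yes; no; contradiction)
open import Relation.Nullary.Decidable using (map′; decidable-stable; _×-dec_; _⊎-dec_; _→-dec_)
open import Relation.Unary using (Decidable)

private
  variable
    s n n' : ℕ

edgeCol-sym : (χ : Colouring n) (x y : Fin n) → edgeCol χ x y ≡ edgeCol χ y x
edgeCol-sym χ x y with x <? y | y <? x
... | yes x<y | yes y<x = ⊥-elim (<-asym x<y y<x)
... | yes _   | no  _   = refl
... | no  _   | yes _   = refl
... | no x≮y  | no y≮x with <-cmp x y
...   | tri< x<y _ _  = contradiction x<y x≮y
...   | tri≈ _ refl _ = refl
...   | tri> _ _ y<x  = contradiction y<x y≮x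

edgeCol-of-symmetric : (χ : Colouring n) → (∀ x y → χ x y ≡ χ y x) →
  ∀ x y → edgeCol χ x y ≡ χ x y
edgeCol-of-symmetric χ χ-sym x y with x <? y
... | yes _ = refl
... | no  _ = χ-sym y x

wlog-< : {P : Fin s → Fin s → Set} → (∀ {i j} → P i j → P j i) →
  (∀ {i j} → i < j → P i j) → ∀ {i j} → i ≢ j → P i j
wlog-< P-sym P-ordered {i} {j} i≢j with <-cmp i j
... | tri< i<j _ _ = P-ordered i<j
... | tri≈ _ i≡j _ = contradiction i≡j i≢j
... | tri> _ _ j<i = P-sym (P-ordered j<i)

strictlyMonotone⇒injective : ∀ {k} {σ : Fin k → Fin s} → σ Preserves _<_ ⟶ _<_ →
  Injective _≡_ _≡_ σ
strictlyMonotone⇒injective σ-mono {i} {j} σi≡σj with <-cmp i j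
... | tri< i<j _ _ = contradiction σi≡σj (<⇒≢ (σ-mono i<j))
... | tri≈ _ i≡j _ = i≡j
... | tri> _ _ j<i = contradiction (sym σi≡σj) (<⇒≢ (σ-mono j<i))

inject₁-monotone : inject₁ {n} Preserves _<_ ⟶ _<_
inject₁-monotone {x = i} {j} i<j = subst₂ ℕ._<_ (sym (toℕ-inject₁ i)) (sym (toℕ-inject₁ j)) i<j

inject₁<fromℕ : (i : Fin n) → inject₁ i < fromℕ n
inject₁<fromℕ {n} i = ℕ<⇒inject₁< (subst (toℕ i ℕ.<_) (sym (toℕ-fromℕ n)) (toℕ<n i))

triple : Fin n → Fin n → Fin n → Fin 3 → Fin n
triple x y z = x ∷ y ∷ z ∷ λ ()

triple-monotone : {x y z : Fin n} → x < y → y < z → triple x y z Preserves _<_ ⟶ _<_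
triple-monotone x<y y<z {zero}       {suc zero}       _ = x<y
triple-monotone x<y y<z {zero}       {suc (suc zero)} _ = <-trans x<y y<z
triple-monotone x<y y<z {suc zero}   {suc (suc zero)} _ = y<z
triple-monotone _ _ {zero}           {zero} ()
triple-monotone _ _ {suc _}          {zero} ()
triple-monotone _ _ {suc zero}       {suc zero} (s≤s ())
triple-monotone _ _ {suc (suc zero)} {suc zero} (s≤s ())
triple-monotone _ _ {suc (suc zero)} {suc (suc zero)} (s≤s (s≤s ()))

injective-or-collision : ∀ {a} (Z : Fin s → Fin a) →
  Injective _≡_ _≡_ Z ⊎ ∃₂ λ i j → i < j × Z i ≡ Z j
injective-or-collision Z with any? (λ i → any? (λ j → (i <? j) ×-dec (Z i ≟ Z j)))
... | yes (i , j , collision) = inj₂ (i , j , collision)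
... | no no-collision = inj₁ λ {i} {j} Zi≡Zj → decidable-stable (i ≟ j) λ i≢j →
  wlog-< (λ Zi≢Zj → Zi≢Zj ∘ sym) (λ {i} {j} i<j Zi≡Zj → no-collision (i , j , i<j , Zi≡Zj))
    i≢j Zi≡Zj

SamePattern : Colouring n → (Fin s → Fin n) → Colouring n' → (Fin s → Fin n') → Set
SamePattern χ f χ' g = ∀ {i j i' j'} → i < j → i' < j' →
  (edgeCol χ (f i) (f j) ≡ edgeCol χ (f i') (f j')) ⇔
  (edgeCol χ' (g i) (g j) ≡ edgeCol χ' (g i') (g j'))

samePattern-recolour : {χ : Colouring n} {χ' : Colouring n'} {f : Fin s → Fin n} {g : Fin s → Fin n'}
  {T : ℕ → ℕ} → Injective _≡_ _≡_ T →
  (∀ i j → i < j → edgeCol χ (f i) (f j) ≡ T (edgeCol χ' (g i) (g j))) → SamePattern χ f χ' g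
samePattern-recolour {T = T} T-inj recoloured {i} {j} {i'} {j'} i<j i'<j' = mk⇔
  (λ same → T-inj (trans (sym (recoloured i j i<j)) (trans same (recoloured i' j' i'<j'))))
  (λ same → trans (recoloured i j i<j) (trans (cong T same) (sym (recoloured i' j' i'<j'))))

samePattern-≗ : (χ : Colouring n) {f g : Fin s → Fin n} → (∀ i → f i ≡ g i) →
  SamePattern χ f χ g
samePattern-≗ χ {f} {g} f≗g =
  samePattern-recolour {χ = χ} {χ} {f} {g} id λ i j _ → cong₂ (edgeCol χ) (f≗g i) (f≗g j)

Pattern : Set₁
Pattern = ∀ {s n} → Colouring n → (Fin s → Fin n) → Set

Invariant : Pattern → Set
Invariant P = ∀ {s n n'} (χ : Colouring n) (χ' : Colouring n')
  (f : Fin s → Fin n) (g : Fin s → Fin n') →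
  SamePattern χ f χ' g → P χ f → P χ' g

Mono-invariant : Invariant Mono
Mono-invariant _ _ _ _ same M i j i' j' i<j i'<j' = Equivalence.to (same i<j i'<j') (M i j i' j' i<j i'<j')

Rainbow-invariant : Invariant Rainbow
Rainbow-invariant _ _ _ _ same R i j i' j' i<j i'<j' =
  R i j i' j' i<j i'<j' ∘ Equivalence.from (same i<j i'<j')

Lexical-invariant : Invariant Lexical
Lexical-invariant _ _ _ _ same L i j i' j' i<j i'<j' = mk⇔
  (Equivalence.to (L i j i' j' i<j i'<j') ∘ Equivalence.from (same i<j i'<j'))
  (Equivalence.to (same i<j i'<j') ∘ Equivalence.from (L i j i' j' i<j i'<j'))

Lexical-∘-monotone : ∀ {k} {χ : Colouring n} {f : Fin s → Fin n} {σ : Fin k → Fin s} →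
  σ Preserves _<_ ⟶ _<_ → Lexical χ f → Lexical χ (f ∘ σ)
Lexical-∘-monotone σ-mono L i j i' j' i<j i'<j' = mk⇔
  (strictlyMonotone⇒injective σ-mono ∘ Equivalence.to (L _ _ _ _ (σ-mono i<j) (σ-mono i'<j')))
  (Equivalence.from (L _ _ _ _ (σ-mono i<j) (σ-mono i'<j')) ∘ cong _)

Mono-unordered : {χ : Colouring n} {f : Fin s → Fin n} → Mono χ f →
  ∀ {i j i' j'} → i ≢ j → i' ≢ j' → edgeCol χ (f i) (f j) ≡ edgeCol χ (f i') (f j')
Mono-unordered {χ = χ} {f} M i≢j i'≢j' = wlog-<
  (λ {i} {j} same i'≢j' → trans (edgeCol-sym χ (f j) (f i)) (same i'≢j'))
  (λ {i} {j} i<j → wlog-<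
     (λ {i'} {j'} same → trans same (edgeCol-sym χ (f i') (f j')))
     (λ {i'} {j'} i'<j' → M i j i' j' i<j i'<j'))
  i≢j i'≢j'

SameEdge : Fin s → Fin s → Fin s → Fin s → Set
SameEdge i j i' j' = (i ≡ i' × j ≡ j') ⊎ (i ≡ j' × j ≡ i')

Rainbow-unordered : {χ : Colouring n} {f : Fin s → Fin n} → Rainbow χ f →
  ∀ {i j i' j'} → i ≢ j → i' ≢ j' →
  edgeCol χ (f i) (f j) ≡ edgeCol χ (f i') (f j') → SameEdge i j i' j'
Rainbow-unordered {χ = χ} {f} R i≢j i'≢j' = wlog-<
  {P = λ i j → ∀ {i' j'} → i' ≢ j' →
         edgeCol χ (f i) (f j) ≡ edgeCol χ (f i') (f j') → SameEdge i j i' j'}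
  (λ {i} {j} same i'≢j' → swapˡ ∘ same i'≢j' ∘ trans (edgeCol-sym χ (f i) (f j)))
  (λ {i} {j} i<j → wlog-<
     {P = λ i' j' → edgeCol χ (f i) (f j) ≡ edgeCol χ (f i') (f j') → SameEdge i j i' j'}
     (λ {i'} {j'} same → swapʳ ∘ same ∘ flip trans (edgeCol-sym χ (f j') (f i')))
     (λ {i'} {j'} i'<j' → inj₁ ∘ R i j i' j' i<j i'<j'))
  i≢j i'≢j'
  where
  swapˡ : ∀ {i j i' j'} → SameEdge i j i' j' → SameEdge j i i' j'
  swapˡ (inj₁ (i≡i' , j≡j')) = inj₂ (j≡j' , i≡i')
  swapˡ (inj₂ (i≡j' , j≡i')) = inj₁ (j≡i' , i≡j')
  swapʳ : ∀ {i j i' j'} → SameEdge i j i' j' → SameEdge i j j' i'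
  swapʳ (inj₁ (i≡i' , j≡j')) = inj₂ (i≡i' , j≡j')
  swapʳ (inj₂ (i≡j' , j≡i')) = inj₁ (i≡j' , j≡i')

Has : Pattern → ℕ → Colouring n → Set
Has {n} P s χ = Σ (Embedding s n) λ e → P χ (proj₁ e)

2*-injective : Injective _≡_ _≡_ (2 *_)
2*-injective {m} {n} = *-cancelˡ-≡ m n 2

1+2*-injective : Injective _≡_ _≡_ (λ c → suc (2 * c))
1+2*-injective eq = 2*-injective (suc-injective eq)

module Product {A B : ℕ} (χ₁ : Colouring A) (χ₂ : Colouring B) where

  block : Fin (A * B) → Fin A
  block u = proj₁ (remQuot {A} B u)

  position : Fin (A * B) → Fin B
  position u = proj₂ (remQuot {A} B u)

  product : Colouring (A * B)
  product u v with block u ≟ block v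
  ... | yes _ = suc (2 * edgeCol χ₂ (position u) (position v))
  ... | no  _ = 2 * edgeCol χ₁ (block u) (block v)

  product-sym : ∀ u v → product u v ≡ product v u
  product-sym u v with block u ≟ block v | block v ≟ block u
  ... | yes _  | yes _  = cong (λ c → suc (2 * c)) (edgeCol-sym χ₂ (position u) (position v))
  ... | no  _  | no  _  = cong (2 *_) (edgeCol-sym χ₁ (block u) (block v))
  ... | yes eq | no  ne = contradiction (sym eq) ne
  ... | no  ne | yes eq = contradiction (sym eq) ne

  product-within : ∀ {u v} → block u ≡ block v →
    edgeCol product u v ≡ suc (2 * edgeCol χ₂ (position u) (position v))
  product-within {u} {v} eq rewrite edgeCol-of-symmetric product product-sym u v
    with block u ≟ block v
  ... | yes _ = refl
  ... | no ne = contradiction eq ne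

  product-between : ∀ {u v} → block u ≢ block v →
    edgeCol product u v ≡ 2 * edgeCol χ₁ (block u) (block v)
  product-between {u} {v} ne rewrite edgeCol-of-symmetric product product-sym u v
    with block u ≟ block v
  ... | yes eq = contradiction eq ne
  ... | no _ = refl

  within≢between : ∀ {u v u' v'} → block u ≡ block v → block u' ≢ block v' →
    edgeCol product u v ≢ edgeCol product u' v'
  within≢between {u} {v} {u'} {v'} within between same =
    even≢odd (edgeCol χ₁ (block u') (block v')) (edgeCol χ₂ (position u) (position v))
      (sym (trans (sym (product-within within)) (trans same (product-between between))))

  block-position-injective : ∀ {u v} → block u ≡ block v → position u ≡ position v → u ≡ v
  block-position-injective {u} {v} eq₁ eq₂ = begin
    u                              ≡⟨ combine-remQuot {A} B u ⟨
    combine (block u) (position u) ≡⟨ cong₂ combine eq₁ eq₂ ⟩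
    combine (block v) (position v) ≡⟨ combine-remQuot {A} B v ⟩
    v                              ∎
    where open ≡-Reasoning

  SameBlock : (Fin s → Fin (A * B)) → Set
  SameBlock f = ∀ i j → block (f i) ≡ block (f j)

  sameBlock-by-contradiction : {f : Fin s → Fin (A * B)} (i : Fin s) →
    (∀ k → ¬ block (f k) ≢ block (f i)) → SameBlock f
  sameBlock-by-contradiction {f = f} i stable k k' = trans (at k) (sym (at k'))
    where
    at : ∀ k → block (f k) ≡ block (f i)
    at k = decidable-stable (block (f k) ≟ block (f i)) (stable k)

  spread : {P : Pattern} → Invariant P → ((f , _) : Embedding s (A * B)) → P product f →
    Injective _≡_ _≡_ (block ∘ f) → Has P s χ₁
  spread P-inv (f , _) Pf block-inj = (block ∘ f , block-inj) ,
    P-inv product χ₁ f (block ∘ f)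
      (samePattern-recolour {χ = product} {χ₁} {f} {block ∘ f} 2*-injective
        λ i j i<j → product-between (<⇒≢ i<j ∘ block-inj))
      Pf

  within : {P : Pattern} → Invariant P → ((f , _) : Embedding s (A * B)) → P product f →
    SameBlock f → Has P s χ₂
  within P-inv (f , f-inj) Pf same = (position ∘ f , f-inj ∘ block-position-injective (same _ _)) ,
    P-inv product χ₂ f (position ∘ f)
      (samePattern-recolour {χ = product} {χ₂} {f} {position ∘ f} 1+2*-injective
        λ i j _ → product-within (same i j))
      Pf

  Mono-split : {f : Fin s → Fin (A * B)} → Mono product f →
    Injective _≡_ _≡_ (block ∘ f) ⊎ SameBlock f
  Mono-split {f = f} M with injective-or-collision (block ∘ f)
  ... | inj₁ block-inj = inj₁ block-inj
  ... | inj₂ (i , j , i<j , collide) = inj₂ (sameBlock-by-contradiction i λ k apart →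
    within≢between collide (apart ∘ sym)
      (Mono-unordered {χ = product} {f} M (<⇒≢ i<j)
        (λ i≡k → apart (cong (block ∘ f) (sym i≡k)))))

  Rainbow-split : {f : Fin s → Fin (A * B)} → Rainbow product f →
    Injective _≡_ _≡_ (block ∘ f) ⊎ SameBlock f
  Rainbow-split {f = f} R with injective-or-collision (block ∘ f)
  ... | inj₁ block-inj = inj₁ block-inj
  ... | inj₂ (i , j , i<j , collide) = inj₂ (sameBlock-by-contradiction i λ k apart →
    -- a vertex outside the block of v_i and v_j would see them along edges of equal colour
    let apart' = apart ∘ flip trans (sym collide)
        same = begin
          edgeCol product (f k) (f i)                ≡⟨ product-between apart ⟩
          2 * edgeCol χ₁ (block (f k)) (block (f i)) ≡⟨ cong ((2 *_) ∘ edgeCol χ₁ (block (f k))) collide ⟩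
          2 * edgeCol χ₁ (block (f k)) (block (f j)) ≡⟨ product-between apart' ⟨
          edgeCol product (f k) (f j)                ∎
    in case Rainbow-unordered {χ = product} {f} R
              (apart ∘ cong (block ∘ f)) (apart' ∘ cong (block ∘ f)) same of λ where
      (inj₁ (_ , i≡j)) → <⇒≢ i<j i≡j
      (inj₂ (k≡j , _)) → apart' (cong (block ∘ f) k≡j))
    where open ≡-Reasoning

  project : {P : Pattern} → Invariant P → (e : Embedding s (A * B)) → P product (proj₁ e) →
    Injective _≡_ _≡_ (block ∘ proj₁ e) ⊎ SameBlock (proj₁ e) → Has P s χ₁ ⊎ Has P s χ₂
  project {P = P} P-inv e Pe = Sum.map (spread {P = P} P-inv e Pe) (within {P = P} P-inv e Pe)

  Lexical-split : ∀ {l} → Has Lexical (suc l) product → Has Lexical l χ₁ ⊎ Has Lexical 3 χ₂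
  Lexical-split {l} ((f , f-inj) , L) with injective-or-collision (block ∘ f ∘ inject₁)
  ... | inj₁ block-inj = inj₁ (spread {P = Lexical} Lexical-invariant
          (f ∘ inject₁ , λ eq → inject₁-injective (f-inj eq))
          (Lexical-∘-monotone {χ = product} {f} inject₁-monotone L) block-inj)
  ... | inj₂ (i , j , i<j , collide) = inj₂ (within {P = Lexical} Lexical-invariant
          (f ∘ σ , λ eq → strictlyMonotone⇒injective σ-mono (f-inj eq))
          (Lexical-∘-monotone {χ = product} {f} σ-mono L)
          (sameBlock-by-contradiction zero in-block))
    where
    σ : Fin 3 → Fin (suc l)
    σ = triple (inject₁ i) (inject₁ j) (fromℕ l)
    σ-mono : σ Preserves _<_ ⟶ _<_
    σ-mono = triple-monotone (inject₁-monotone i<j) (inject₁<fromℕ j)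
    in-block : ∀ k → ¬ block (f (σ k)) ≢ block (f (σ zero))
    in-block zero             apart = apart refl
    in-block (suc zero)       apart = apart (sym collide)
    -- v_i v_last starts at v_i like v_i v_j, so it has the same (odd) colour
    in-block (suc (suc zero)) apart = within≢between collide (apart ∘ sym)
      (Equivalence.from (L _ _ _ _ (inject₁-monotone i<j) (inject₁<fromℕ i)) refl)

  product-split : ∀ {m l r} → HasMono m product ⊎ (HasLex (suc l) product ⊎ HasRainbow r product) →
    (HasMono m χ₁ ⊎ (HasLex l χ₁ ⊎ HasRainbow r χ₁)) ⊎
    (HasMono m χ₂ ⊎ (HasLex 3 χ₂ ⊎ HasRainbow r χ₂))
  product-split (inj₁ (e , M)) =
    Sum.map inj₁ inj₁ (project {P = Mono} Mono-invariant e M (Mono-split M))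
  product-split (inj₂ (inj₁ lexical)) =
    Sum.map (inj₂ ∘ inj₁) (inj₂ ∘ inj₁) (Lexical-split lexical)
  product-split (inj₂ (inj₂ (e , R))) =
    Sum.map (inj₂ ∘ inj₂) (inj₂ ∘ inj₂)
      (project {P = Rainbow} Rainbow-invariant e R (Rainbow-split R))

Injective? : (f : Fin s → Fin n) → Dec (Injective _≡_ _≡_ f)
Injective? f = map′ (λ inj {i} {j} → inj i j) (λ inj i j → inj {i} {j})
  (all? λ i → all? λ j → (f i ≟ f j) →-dec (i ≟ j))

∃-function? : ∀ s {n} {P : (Fin s → Fin n) → Set} →
  (∀ {f g} → (∀ i → f i ≡ g i) → P f → P g) → Decidable P → Dec (∃ P)
∃-function? ℕ.zero P-ext P? = map′ (_ ,_) (λ (_ , Pf) → P-ext (λ ()) Pf) (P? λ ())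
∃-function? (suc s) P-ext P? =
  map′ (λ (x , g , Pxg) → x ∷ g , Pxg) (λ (f , Pf) → head f , tail f , P-ext head∷tail Pf)
    (any? λ x → ∃-function? s (λ f≗g → P-ext (∷-cong x f≗g)) (P? ∘ (x ∷_)))
  where
  head∷tail : {f : Fin (suc s) → Fin _} → ∀ i → f i ≡ (head f ∷ tail f) i
  head∷tail zero    = refl
  head∷tail (suc _) = refl
  ∷-cong : ∀ {n} (x : Fin n) {f g : Fin s → Fin n} → (∀ i → f i ≡ g i) →
    ∀ i → (x ∷ f) i ≡ (x ∷ g) i
  ∷-cong x f≗g zero    = refl
  ∷-cong x f≗g (suc i) = f≗g i

Has? : {P : Pattern} → Invariant P →
  (∀ {s n} (χ : Colouring n) (f : Fin s → Fin n) → Dec (P χ f)) → ∀ s (χ : Colouring n) → Dec (Has P s χ)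
Has? {P = P} P-inv P? s χ = map′ (λ (f , f-inj , Pf) → (f , λ {i} {j} → f-inj {i} {j}) , Pf)
  (λ ((f , f-inj) , Pf) → f , (λ {i} {j} → f-inj {i} {j}) , Pf)
  (∃-function? s transport λ f → Injective? f ×-dec P? χ f)
  where
  transport : ∀ {f g} → (∀ i → f i ≡ g i) → Injective _≡_ _≡_ f × P χ f → Injective _≡_ _≡_ g × P χ g
  transport {f} {g} f≗g (f-inj , Pf) =
    (λ {i} {j} gi≡gj → f-inj (trans (f≗g i) (trans gi≡gj (sym (f≗g j))))) ,
    P-inv χ χ f g (samePattern-≗ χ f≗g) Pf

_⇔?_ : {P Q : Set} → Dec P → Dec Q → Dec (P ⇔ Q)
P? ⇔? Q? = map′ (λ (to , from) → mk⇔ to from)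
  (λ P⇔Q → Equivalence.to P⇔Q , Equivalence.from P⇔Q)
  ((P? →-dec Q?) ×-dec (Q? →-dec P?))

Mono? : (χ : Colouring n) (f : Fin s → Fin n) → Dec (Mono χ f)
Mono? χ f = all? λ i → all? λ j → all? λ i' → all? λ j' → (i <? j) →-dec (i' <? j') →-dec
  edgeCol χ (f i) (f j) ℕ.≟ edgeCol χ (f i') (f j')

Rainbow? : (χ : Colouring n) (f : Fin s → Fin n) → Dec (Rainbow χ f)
Rainbow? χ f = all? λ i → all? λ j → all? λ i' → all? λ j' → (i <? j) →-dec (i' <? j') →-dec
  (edgeCol χ (f i) (f j) ℕ.≟ edgeCol χ (f i') (f j')) →-dec (i ≟ i') ×-dec (j ≟ j')

Lexical? : (χ : Colouring n) (f : Fin s → Fin n) → Dec (Lexical χ f)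
Lexical? χ f = all? λ i → all? λ j → all? λ i' → all? λ j' → (i <? j) →-dec (i' <? j') →-dec
  (edgeCol χ (f i) (f j) ℕ.≟ edgeCol χ (f i') (f j')) ⇔? (i ≟ i')

-- read through edgeCol, so that the restriction is symmetric whatever χ is below the diagonal
restrict : ∀ {m} → m ≤ n → Colouring n → Colouring m
restrict m≤n χ x y = edgeCol χ (inject≤ x m≤n) (inject≤ y m≤n)

edgeCol-restrict : ∀ {m} (m≤n : m ≤ n) (χ : Colouring n) x y →
  edgeCol (restrict m≤n χ) x y ≡ edgeCol χ (inject≤ x m≤n) (inject≤ y m≤n)
edgeCol-restrict m≤n χ = edgeCol-of-symmetric (restrict m≤n χ) λ x y →
  edgeCol-sym χ (inject≤ x m≤n) (inject≤ y m≤n)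

Has-restrict : ∀ {m} {P : Pattern} → Invariant P → (m≤n : m ≤ n) (χ : Colouring n) →
  Has P s (restrict m≤n χ) → Has P s χ
Has-restrict P-inv m≤n χ ((f , f-inj) , Pf) =
  (ι ∘ f , λ eq → f-inj (inject≤-injective m≤n m≤n _ _ eq)) ,
  P-inv _ χ f (ι ∘ f) (samePattern-recolour {χ = restrict m≤n χ} {χ} {f} {ι ∘ f} id
    λ i j _ → edgeCol-restrict m≤n χ (f i) (f j)) Pf
  where
  ι : Fin _ → Fin _
  ι x = inject≤ x m≤n

Arrows-monotone : ∀ {m a b c} → m ≤ n → Arrows m a b c → Arrows n a b c
Arrows-monotone m≤n arrows χ =
  Sum.map (Has-restrict {P = Mono} Mono-invariant m≤n χ)
    (Sum.map (Has-restrict {P = Lexical} Lexical-invariant m≤n χ)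
             (Has-restrict {P = Rainbow} Rainbow-invariant m≤n χ))
    (arrows (restrict m≤n χ))

∀⊎∀-left : {X Y : Set} {P : X → Set} {Q : Y → Set} → Decidable P →
  (∀ x y → P x ⊎ Q y) → ¬ (∀ y → Q y) → ∀ x → P x
∀⊎∀-left P? P⊎Q ¬∀Q x = decidable-stable (P? x) λ ¬Px →
  ¬∀Q λ y → Sum.fromInj₂ (λ Px → contradiction Px ¬Px) (P⊎Q x y)

product-lower-bound : ∀ {A B m l r} → Arrows (A * B) m (suc l) r → ¬ Arrows B m 3 r → Arrows A m l r
product-lower-bound {m = m} {l} {r} arrows =
  ∀⊎∀-left (λ χ → Has? {P = Mono} Mono-invariant Mono? m χ
              ⊎-dec Has? {P = Lexical} Lexical-invariant Lexical? l χ
              ⊎-dec Has? {P = Rainbow} Rainbow-invariant Rainbow? r χ)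
    (λ χ₁ χ₂ → Product.product-split χ₁ χ₂ (arrows (Product.product χ₁ χ₂)))

¬Arrows-0 : ∀ {m l r} → ¬ Arrows 0 (suc m) (suc l) (suc r)
¬Arrows-0 arrows with arrows (λ ())
... | inj₁ ((f , _) , _)        = ¬Fin0 (f zero)
... | inj₂ (inj₁ ((f , _) , _)) = ¬Fin0 (f zero)
... | inj₂ (inj₂ ((f , _) , _)) = ¬Fin0 (f zero)

IsER⇒¬Arrows-pred : ∀ {N m l r} → IsER N (suc m) (suc l) (suc r) →
  ¬ Arrows (N ∸ 1) (suc m) (suc l) (suc r)
IsER⇒¬Arrows-pred {ℕ.zero} _               = ¬Arrows-0
IsER⇒¬Arrows-pred {suc N}  (_ , minimality) = minimality N (n<1+n N)

mainTheorem3 : ∀ (l r : ℕ) → 3 ≤ l → 3 ≤ r →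
    ∀ (a b c : ℕ) → IsER a 3 l r → IsER b 3 3 r → IsER c 3 (suc l) r →
    (a ∸ 1) * (b ∸ 1) + 1 ≤ c
mainTheorem3 l r (s≤s (s≤s (s≤s _))) (s≤s (s≤s (s≤s _))) a b c ER-a ER-b ER-c =
  subst (_≤ c) (+-comm 1 _) (≰⇒> c≰)
  where
  c≰ : c ≰ (a ∸ 1) * (b ∸ 1)
  c≰ c≤ = IsER⇒¬Arrows-pred ER-a
    (product-lower-bound (Arrows-monotone c≤ (proj₁ ER-c)) (IsER⇒¬Arrows-pred ER-b))
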